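{- Let $n \geq 7$. For any leader permutation $\pi$ of length $n$, the set of permutations in $S_n$ adjacent to $\pi$ is an equivalence class of $S_n$ under the $\{1234,3412\}$-equivalence. Moreover, there are exactly $n-1$ such classes (one for each leader permutation of length $n$).
   Context: Permutations are written in one-line notation $a_1a_2\cdots a_n$; entries are called letters. A leader permutation of length $n$ is a permutation $a_1a_2\cdots a_n\in S_n$ such that for some integer $k\in[2,n]$, $a_i = k-i$ for all $1\le i<k$ and $a_i = n+k-i$ for all $k\le i\le n$ (e.g., for $n=8$: $18765432, 21876543, \ldots, 76543218$). Two permutations $\pi,\rho\in S_n$ are adjacent if neither $\pi$ nor $\rho$ begins with $n$ or ends with $1$, and $\pi$ is obtained from $\rho$ by swapping the positions of two letters $x,y$ with $|x-y|\notin\{1,n-1\}$. A $\{1234,3412\}$-pattern-replacement on a permutation takes four positions $i_1<i_2<i_3<i_4$ whose letters are in increasing order (pattern $1234$) or satisfy $\pi_{i_3}<\pi_{i_4}<\pi_{i_1}<\pi_{i_2}$ (pattern $3412$), and swaps the letters in positions $i_1,i_3$ and in positions $i_2,i_4$, turning one pattern into the other. Two permutations are equivalent under the $\{1234,3412\}$-equivalence if one can be reached from the other by a finite sequence of such replacements. -}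

module Defs where

open import Data.Nat using (ℕ; zero; suc; _+_; _∸_; _≤_; _<_; ∣_-_∣)
open import Data.Fin as F using (Fin; toℕ)
open import Data.Vec using (Vec; lookup; toList; _[_]≔_)
open import Data.List using (List; map; upTo)
open import Data.List.Relation.Binary.Permutation.Propositional using (_↭_)
open import Data.Product using (Σ; ∃; _×_; Σ-syntax; ∃-syntax)
open import Data.Sum using (_⊎_)
open import Relation.Nullary using (¬_)
open import Relation.Binary.PropositionalEquality using (_≡_; _≢_)
open import Relation.Binary.Construct.Closure.ReflexiveTransitive using (Star)

-- A word of length n over ℕ in one-line notation; position i : Fin n is the
-- (toℕ i + 1)-th entry.  Letters are 1..n as in the paper.
Word : ℕ → Set
Word n = Vec ℕ n

IsPerm : (n : ℕ) → Word n → Set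
IsPerm n v = toList v ↭ map suc (upTo n)

BeginsWithN : (n : ℕ) → Word n → Set
BeginsWithN n v = Σ[ i ∈ Fin n ] (toℕ i ≡ 0 × lookup v i ≡ n)

EndsWith1 : (n : ℕ) → Word n → Set
EndsWith1 n v = Σ[ i ∈ Fin n ] (toℕ i ≡ n ∸ 1 × lookup v i ≡ 1)

swapAt : {n : ℕ} → Word n → Fin n → Fin n → Word n
swapAt v i j = (v [ i ]≔ lookup v j) [ j ]≔ lookup v i

SwapAdmissible : (n : ℕ) → Word n → Word n → Set
SwapAdmissible n π ρ =
  Σ[ i ∈ Fin n ] Σ[ j ∈ Fin n ]
    ( lookup ρ i ≢ lookup ρ j
    × ∣ lookup ρ i - lookup ρ j ∣ ≢ 1
    × ∣ lookup ρ i - lookup ρ j ∣ ≢ n ∸ 1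
    × π ≡ swapAt ρ i j )

Adjacent : (n : ℕ) → Word n → Word n → Set
Adjacent n π ρ =
  ¬ BeginsWithN n π × ¬ EndsWith1 n π ×
  ¬ BeginsWithN n ρ × ¬ EndsWith1 n ρ ×
  SwapAdmissible n π ρ

ReplStep : (n : ℕ) → Word n → Word n → Set
ReplStep n v w =
  Σ[ i₁ ∈ Fin n ] Σ[ i₂ ∈ Fin n ] Σ[ i₃ ∈ Fin n ] Σ[ i₄ ∈ Fin n ]
    ( i₁ F.< i₂ × i₂ F.< i₃ × i₃ F.< i₄
    × ( ( lookup v i₁ < lookup v i₂ × lookup v i₂ < lookup v i₃
        × lookup v i₃ < lookup v i₄ )
      ⊎ ( lookup v i₃ < lookup v i₄ × lookup v i₄ < lookup v i₁
        × lookup v i₁ < lookup v i₂ ) )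
    × w ≡ swapAt (swapAt v i₁ i₃) i₂ i₄ )

Equiv : (n : ℕ) → Word n → Word n → Set
Equiv n = Star (ReplStep n)

-- π is the leader permutation of length n with parameter k
-- (1-based position p = toℕ i + 1)
LeaderWith : (n k : ℕ) → Word n → Set
LeaderWith n k v =
  2 ≤ k × k ≤ n ×
  ((i : Fin n) →
     (suc (toℕ i) < k → lookup v i ≡ k ∸ suc (toℕ i)) ×
     (k ≤ suc (toℕ i) → lookup v i ≡ n + k ∸ suc (toℕ i)))

IsLeader : (n : ℕ) → Word n → Set
IsLeader n v = ∃[ k ] LeaderWith n k v

-- A leader permutation π is the direct sum of two decreasing runs,
-- (m+1)(m)…1 followed by n(n-1)…(m+2), so it contains no 123, 231 or 312.
-- Every permutation adjacent to π is a transposition of π at two positions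
-- p, q with q ≥ p + 2, apart from three forbidden pairs.  A 1234/3412
-- replacement applied to such a transposition must touch exactly the two
-- swapped positions (any three untouched positions would exhibit a forbidden
-- pattern in π), and it then produces another admissible transposition: so
-- adjacency to π is closed under the equivalence.  Conversely, explicit
-- replacements connect every admissible transposition to a fixed one.
-- Finally the adjacency class determines π: transposing positions 1 and 3
-- leaves one of the positions 0, 2, 4 untouched by any other admissible
-- transposition, and a single letter of a leader permutation determines it.
module Submission where

open import Defs
open import Data.Nat
  using (ℕ; zero; suc; _+_; _∸_; _⊓_; _≤_; _<_; z≤n; s≤s; z<s; s<s; ∣_-_∣; _≤?_)
open import Data.Nat.Properties
open import Data.Nat.Tactic.RingSolver using (solve-∀)
open import Data.Fin as F using (Fin; toℕ; fromℕ<; #_)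
open import Data.Fin.Properties
  using (toℕ<n; toℕ-injective; toℕ-fromℕ<; fromℕ<-toℕ; fromℕ<-cong)
  renaming (_≟_ to _≟ᶠ_; <⇒≢ to <⇒≢ᶠ)
open import Data.Vec using (lookup; tabulate; toList; _[_]≔_; _∷_)
open import Data.Vec.Properties
  using (lookup∘update; lookup∘update′; lookup∘tabulate; tabulate∘lookup; tabulate-cong)
open import Data.List as List using (applyUpTo; upTo; _++_)
open import Data.List.Properties using (applyUpTo-∷ʳ; map-upTo)
open import Data.List.Relation.Binary.Permutation.Propositional
  using (_↭_; ↭-refl; ↭-prep; ↭-swap; ↭-trans; ↭-reflexive; module PermutationReasoning)
open import Data.List.Relation.Binary.Permutation.Propositional.Properties using (++⁺; ∷↭∷ʳ)
open import Data.Product using (_×_; _,_; proj₁; proj₂; Σ-syntax; ∃-syntax)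
open import Data.Sum using (_⊎_; inj₁; inj₂)
open import Data.Empty using (⊥; ⊥-elim)
open import Relation.Nullary using (¬_; yes; no)
open import Relation.Binary.PropositionalEquality
open import Relation.Binary.Definitions using (Tri; tri<; tri≈; tri>)
open import Relation.Binary.Construct.Closure.ReflexiveTransitive using (Star; ε; _◅_; reverse)
open import Function.Bundles using (_⇔_; mk⇔; Equivalence)
open import Function.Construct.Identity using (⇔-id)

-- Transpositions of a word

module _ {n : ℕ} where

  lookup-ext : {u w : Word n} → (∀ i → lookup u i ≡ lookup w i) → u ≡ w
  lookup-ext {u} {w} u≗w =
    trans (sym (tabulate∘lookup u)) (trans (tabulate-cong u≗w) (tabulate∘lookup w))

  lookup∘swapAtʳ : ∀ (v : Word n) i j → lookup (swapAt v i j) j ≡ lookup v i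
  lookup∘swapAtʳ v i j = lookup∘update j (v [ i ]≔ lookup v j) (lookup v i)

  lookup∘swapAtˡ : ∀ (v : Word n) i j → lookup (swapAt v i j) i ≡ lookup v j
  lookup∘swapAtˡ v i j with i ≟ᶠ j
  ... | yes refl = lookup∘update i (v [ i ]≔ lookup v i) (lookup v i)
  ... | no i≢j = trans (lookup∘update′ i≢j (v [ i ]≔ lookup v j) (lookup v i))
                       (lookup∘update i v (lookup v j))

  lookup∘swapAt′ : ∀ (v : Word n) i j x → x ≢ i → x ≢ j →
                   lookup (swapAt v i j) x ≡ lookup v x
  lookup∘swapAt′ v i j x x≢i x≢j =
    trans (lookup∘update′ x≢j (v [ i ]≔ lookup v j) (lookup v i))
          (lookup∘update′ x≢i v (lookup v j))

  swapAt-involutive : ∀ (v : Word n) i j → swapAt (swapAt v i j) i j ≡ v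
  swapAt-involutive v i j = lookup-ext pointwise
    where
    pointwise : ∀ x → lookup (swapAt (swapAt v i j) i j) x ≡ lookup v x
    pointwise x with x ≟ᶠ j | x ≟ᶠ i
    ... | yes refl | _ = trans (lookup∘swapAtʳ (swapAt v i x) i x) (lookup∘swapAtˡ v i x)
    ... | no _ | yes refl = trans (lookup∘swapAtˡ (swapAt v x j) x j) (lookup∘swapAtʳ v x j)
    ... | no x≢j | no x≢i =
      trans (lookup∘swapAt′ (swapAt v i j) i j x x≢i x≢j) (lookup∘swapAt′ v i j x x≢i x≢j)

  swapAt-sym : ∀ (v : Word n) i j → swapAt v i j ≡ swapAt v j i
  swapAt-sym v i j = lookup-ext pointwise
    where
    pointwise : ∀ x → lookup (swapAt v i j) x ≡ lookup (swapAt v j i) x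
    pointwise x with x ≟ᶠ j | x ≟ᶠ i
    ... | yes refl | _ = trans (lookup∘swapAtʳ v i x) (sym (lookup∘swapAtˡ v x i))
    ... | no _ | yes refl = trans (lookup∘swapAtˡ v x j) (sym (lookup∘swapAtʳ v j x))
    ... | no x≢j | no x≢i =
      trans (lookup∘swapAt′ v i j x x≢i x≢j) (sym (lookup∘swapAt′ v j i x x≢j x≢i))

  swapAt-comm : ∀ (v : Word n) i j a b → a ≢ i → a ≢ j → b ≢ i → b ≢ j →
                swapAt (swapAt v i j) a b ≡ swapAt (swapAt v a b) i j
  swapAt-comm v i j a b a≢i a≢j b≢i b≢j = lookup-ext pointwise
    where
    open ≡-Reasoning
    outside-ab : ∀ x → x ≢ a → x ≢ b →
                 lookup (swapAt (swapAt v i j) a b) x ≡ lookup (swapAt v i j) x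
    outside-ab = lookup∘swapAt′ (swapAt v i j) a b
    outside-ij : ∀ x → x ≢ i → x ≢ j →
                 lookup (swapAt (swapAt v a b) i j) x ≡ lookup (swapAt v a b) x
    outside-ij = lookup∘swapAt′ (swapAt v a b) i j
    pointwise : ∀ x → lookup (swapAt (swapAt v i j) a b) x ≡ lookup (swapAt (swapAt v a b) i j) x
    pointwise x with x ≟ᶠ b | x ≟ᶠ a | x ≟ᶠ j | x ≟ᶠ i
    ... | yes refl | _ | _ | _ = begin
      lookup (swapAt (swapAt v i j) a x) x ≡⟨ lookup∘swapAtʳ (swapAt v i j) a x ⟩
      lookup (swapAt v i j) a              ≡⟨ lookup∘swapAt′ v i j a a≢i a≢j ⟩
      lookup v a                           ≡⟨ lookup∘swapAtʳ v a x ⟨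
      lookup (swapAt v a x) x              ≡⟨ outside-ij x b≢i b≢j ⟨
      lookup (swapAt (swapAt v a x) i j) x ∎
    ... | no _ | yes refl | _ | _ = begin
      lookup (swapAt (swapAt v i j) x b) x ≡⟨ lookup∘swapAtˡ (swapAt v i j) x b ⟩
      lookup (swapAt v i j) b              ≡⟨ lookup∘swapAt′ v i j b b≢i b≢j ⟩
      lookup v b                           ≡⟨ lookup∘swapAtˡ v x b ⟨
      lookup (swapAt v x b) x              ≡⟨ outside-ij x a≢i a≢j ⟨
      lookup (swapAt (swapAt v x b) i j) x ∎
    ... | no x≢b | no x≢a | yes refl | _ = begin
      lookup (swapAt (swapAt v i x) a b) x ≡⟨ outside-ab x x≢a x≢b ⟩
      lookup (swapAt v i x) x              ≡⟨ lookup∘swapAtʳ v i x ⟩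
      lookup v i                           ≡⟨ lookup∘swapAt′ v a b i (≢-sym a≢i) (≢-sym b≢i) ⟨
      lookup (swapAt v a b) i              ≡⟨ lookup∘swapAtʳ (swapAt v a b) i x ⟨
      lookup (swapAt (swapAt v a b) i x) x ∎
    ... | no x≢b | no x≢a | no _ | yes refl = begin
      lookup (swapAt (swapAt v x j) a b) x ≡⟨ outside-ab x x≢a x≢b ⟩
      lookup (swapAt v x j) x              ≡⟨ lookup∘swapAtˡ v x j ⟩
      lookup v j                           ≡⟨ lookup∘swapAt′ v a b j (≢-sym a≢j) (≢-sym b≢j) ⟨
      lookup (swapAt v a b) j              ≡⟨ lookup∘swapAtˡ (swapAt v a b) x j ⟨
      lookup (swapAt (swapAt v a b) x j) x ∎
    ... | no x≢b | no x≢a | no x≢j | no x≢i = begin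
      lookup (swapAt (swapAt v i j) a b) x ≡⟨ outside-ab x x≢a x≢b ⟩
      lookup (swapAt v i j) x              ≡⟨ lookup∘swapAt′ v i j x x≢i x≢j ⟩
      lookup v x                           ≡⟨ lookup∘swapAt′ v a b x x≢a x≢b ⟨
      lookup (swapAt v a b) x              ≡⟨ outside-ij x x≢i x≢j ⟨
      lookup (swapAt (swapAt v a b) i j) x ∎

  swapAt-cancel-across : ∀ (v : Word n) i j a b → a ≢ i → a ≢ j → b ≢ i → b ≢ j →
                         swapAt (swapAt (swapAt v i j) a b) i j ≡ swapAt v a b
  swapAt-cancel-across v i j a b a≢i a≢j b≢i b≢j =
    trans (cong (λ u → swapAt u i j) (swapAt-comm v i j a b a≢i a≢j b≢i b≢j))
          (swapAt-involutive (swapAt v a b) i j)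

  Touched : Fin n → Fin n → Fin n → Set
  Touched p q x = x ≡ p ⊎ x ≡ q

  Untouched : Fin n → Fin n → Fin n → Set
  Untouched p q x = x ≢ p × x ≢ q

  touched? : ∀ p q x → Touched p q x ⊎ Untouched p q x
  touched? p q x with x ≟ᶠ p | x ≟ᶠ q
  ... | yes x≡p | _ = inj₁ (inj₁ x≡p)
  ... | no _ | yes x≡q = inj₁ (inj₂ x≡q)
  ... | no x≢p | no x≢q = inj₂ (x≢p , x≢q)

  touched-pair : ∀ {p q x y} → toℕ p < toℕ q → toℕ x < toℕ y →
                 Touched p q x → Touched p q y → x ≡ p × y ≡ q
  touched-pair p<q x<y (inj₁ refl) (inj₁ refl) = ⊥-elim (<-irrefl refl x<y)
  touched-pair p<q x<y (inj₁ x≡p) (inj₂ y≡q) = x≡p , y≡q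
  touched-pair p<q x<y (inj₂ refl) (inj₁ refl) = ⊥-elim (<-asym p<q x<y)
  touched-pair p<q x<y (inj₂ refl) (inj₂ refl) = ⊥-elim (<-irrefl refl x<y)

  ¬touched-three : ∀ {p q x y z} → toℕ p < toℕ q → toℕ x < toℕ y → toℕ y < toℕ z →
                   Touched p q x → Touched p q y → Touched p q z → ⊥
  ¬touched-three p<q x<y y<z tx ty tz
    with touched-pair p<q x<y tx ty | touched-pair p<q y<z ty tz
  ... | _ , y≡q | y≡p , _ = <-irrefl (cong toℕ (trans (sym y≡p) y≡q)) p<q

lookup∷update-↭ : ∀ {k} (xs : Word k) j z →
                  lookup xs j List.∷ toList (xs [ j ]≔ z) ↭ z List.∷ toList xs
lookup∷update-↭ (w ∷ ws) F.zero z = ↭-swap w z ↭-refl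
lookup∷update-↭ (w ∷ ws) (F.suc j) z =
  ↭-trans (↭-swap _ w ↭-refl) (↭-trans (↭-prep w (lookup∷update-↭ ws j z)) (↭-swap w z ↭-refl))

swapAt-↭ : ∀ {k} (v : Word k) i j → toList (swapAt v i j) ↭ toList v
swapAt-↭ (x ∷ xs) F.zero F.zero = ↭-refl
swapAt-↭ (x ∷ xs) F.zero (F.suc j) = lookup∷update-↭ xs j x
swapAt-↭ (x ∷ xs) (F.suc i) F.zero = lookup∷update-↭ xs i x
swapAt-↭ (x ∷ xs) (F.suc i) (F.suc j) = ↭-prep x (swapAt-↭ xs i j)

Pattern : ℕ → ℕ → ℕ → ℕ → Set
Pattern A B C D = (A < B × B < C × C < D) ⊎ (C < D × D < A × A < B)

Pattern-swap : ∀ {A B C D} → Pattern A B C D → Pattern C D A B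
Pattern-swap (inj₁ p) = inj₂ p
Pattern-swap (inj₂ p) = inj₁ p

Pattern-A<B : ∀ {A B C D} → Pattern A B C D → A < B
Pattern-A<B (inj₁ (A<B , _ , _)) = A<B
Pattern-A<B (inj₂ (_ , _ , A<B)) = A<B

Pattern-C<D : ∀ {A B C D} → Pattern A B C D → C < D
Pattern-C<D (inj₁ (_ , _ , C<D)) = C<D
Pattern-C<D (inj₂ (C<D , _ , _)) = C<D

Pattern-cong : ∀ {A B C D A′ B′ C′ D′} → A ≡ A′ → B ≡ B′ → C ≡ C′ → D ≡ D′ →
               Pattern A B C D → Pattern A′ B′ C′ D′
Pattern-cong refl refl refl refl p = p

replStep-sym : ∀ {n} {v w : Word n} → ReplStep n v w → ReplStep n w v
replStep-sym {v = v} (a , b , c , d , a<b , b<c , c<d , pat , refl) =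
  a , b , c , d , a<b , b<c , c<d ,
  Pattern-cong (sym at-a) (sym at-b) (sym at-c) (sym at-d) (Pattern-swap pat) , back
  where
  b≢a = ≢-sym (<⇒≢ᶠ a<b)
  b≢c = <⇒≢ᶠ b<c
  d≢a = ≢-sym (<⇒≢ᶠ (<-trans a<b (<-trans b<c c<d)))
  d≢c = ≢-sym (<⇒≢ᶠ c<d)
  u = swapAt v a c
  at-a : lookup (swapAt u b d) a ≡ lookup v c
  at-a = trans (lookup∘swapAt′ u b d a (≢-sym b≢a) (≢-sym d≢a)) (lookup∘swapAtˡ v a c)
  at-b : lookup (swapAt u b d) b ≡ lookup v d
  at-b = trans (lookup∘swapAtˡ u b d) (lookup∘swapAt′ v a c d d≢a d≢c)
  at-c : lookup (swapAt u b d) c ≡ lookup v a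
  at-c = trans (lookup∘swapAt′ u b d c (≢-sym b≢c) (≢-sym d≢c)) (lookup∘swapAtʳ v a c)
  at-d : lookup (swapAt u b d) d ≡ lookup v b
  at-d = trans (lookup∘swapAtʳ u b d) (lookup∘swapAt′ v a c b b≢a b≢c)
  back : v ≡ swapAt (swapAt (swapAt u b d) a c) b d
  back = sym (trans (cong (λ x → swapAt x b d) (swapAt-cancel-across v a c b d b≢a b≢c d≢a d≢c))
                    (swapAt-involutive v b d))

sum-constant⇒antitone : ∀ {x y p q C} → x + p ≡ C → y + q ≡ C → p < q → y < x
sum-constant⇒antitone {x} {y} {p} {q} x+p≡C y+q≡C p<q =
  +-cancelʳ-< q y x (subst (_< x + q) (trans x+p≡C (sym y+q≡C)) (+-monoʳ-< x p<q))

∣m+n-m∣≡n : ∀ m n → ∣ m + n - m ∣ ≡ n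
∣m+n-m∣≡n m n = trans (∣-∣-comm (m + n) m) (∣m-m+n∣≡n m n)

sums-equal⇒distance : ∀ {x y p t C} → x + p ≡ C → y + (p + t) ≡ C → ∣ x - y ∣ ≡ t
sums-equal⇒distance {x} {y} {p} {t} {C} x+p≡C y+p+t≡C = begin
  ∣ x - y ∣     ≡⟨ cong (λ z → ∣ z - y ∣) x≡y+t ⟩
  ∣ y + t - y ∣ ≡⟨ ∣m+n-m∣≡n y t ⟩
  t             ∎
  where
  open ≡-Reasoning
  x≡y+t : x ≡ y + t
  x≡y+t = +-cancelʳ-≡ p x (y + t) (begin
    x + p       ≡⟨ x+p≡C ⟩
    C           ≡⟨ y+p+t≡C ⟨
    y + (p + t) ≡⟨ cong (y +_) (+-comm p t) ⟩
    y + (t + p) ≡⟨ +-assoc y t p ⟨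
    y + t + p   ∎)

AvoidsEnds : ℕ → ℕ → Set
AvoidsEnds n' δ = δ ≢ 1 × δ ≢ n'

avoidsEnds-complement : ∀ {n' δ t} → δ + t ≡ suc n' → AvoidsEnds n' δ → AvoidsEnds n' t
avoidsEnds-complement {n'} {δ} δ+t≡n (δ≢1 , δ≢n') =
  (λ { refl → δ≢n' (+-cancelʳ-≡ 1 δ n' (trans δ+t≡n (+-comm 1 n'))) }) ,
  (λ { refl → δ≢1 (+-cancelʳ-≡ n' δ 1 δ+t≡n) })

avoidsEnds-transfer : ∀ {n' δ t} → δ ≡ t ⊎ δ + t ≡ suc n' → AvoidsEnds n' δ ⇔ AvoidsEnds n' t
avoidsEnds-transfer (inj₁ refl) = ⇔-id _
avoidsEnds-transfer {δ = δ} {t} (inj₂ δ+t≡n) =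
  mk⇔ (avoidsEnds-complement δ+t≡n) (avoidsEnds-complement (trans (+-comm t δ) δ+t≡n))

avoidsEnds⇒gap : ∀ {n' p t} → 0 < t → AvoidsEnds n' t → suc p < p + t × ¬ (p ≡ 0 × p + t ≡ n')
avoidsEnds⇒gap {p = p} {t} 0<t (t≢1 , t≢n') =
  subst (_≤ p + t) (+-comm p 2) (+-monoʳ-≤ p (≤∧≢⇒< 0<t (≢-sym t≢1))) ,
  λ { (refl , t≡n') → t≢n' t≡n' }

gap⇒avoidsEnds : ∀ {n'} p {t} → p + t < suc n' → suc p < p + t → ¬ (p ≡ 0 × p + t ≡ n') →
                 AvoidsEnds n' t
gap⇒avoidsEnds p {t} q<n gap ¬first-last = t≢1 , t≢n' p q<n ¬first-last
  where
  t≢1 : t ≢ 1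
  t≢1 refl = <-irrefl (sym (+-comm p 1)) gap
  t≢n' : ∀ {n'} p → p + t < suc n' → ¬ (p ≡ 0 × p + t ≡ n') → t ≢ n'
  t≢n' zero _ ¬first-last t≡n' = ¬first-last (refl , t≡n')
  t≢n' (suc p) q<n _ refl = <⇒≱ (≤-pred q<n) (m≤n+m t p)

module _ {A : Set} where

  toList∘tabulate : ∀ k (g : ℕ → A) → toList (tabulate {n = k} (λ i → g (toℕ i))) ≡ applyUpTo g k
  toList∘tabulate zero g = refl
  toList∘tabulate (suc k) g = cong (g 0 List.∷_) (toList∘tabulate k (λ p → g (suc p)))

  applyUpTo-++ : ∀ (f : ℕ → A) a b →
                 applyUpTo f (a + b) ≡ applyUpTo f a ++ applyUpTo (λ p → f (a + p)) b
  applyUpTo-++ f zero b = refl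
  applyUpTo-++ f (suc a) b = cong (f 0 List.∷_) (applyUpTo-++ (λ p → f (suc p)) a b)

  applyUpTo-cong : ∀ (f g : ℕ → A) a → (∀ p → p < a → f p ≡ g p) → applyUpTo f a ≡ applyUpTo g a
  applyUpTo-cong f g zero f≗g = refl
  applyUpTo-cong f g (suc a) f≗g =
    cong₂ List._∷_ (f≗g 0 z<s)
                   (applyUpTo-cong (λ p → f (suc p)) (λ p → g (suc p)) a (λ p p<a → f≗g (suc p) (s<s p<a)))

descending-run-↭ : ∀ c a → applyUpTo (λ p → c + (a ∸ p)) a ↭ applyUpTo (λ p → c + suc p) a
descending-run-↭ c zero = ↭-refl
descending-run-↭ c (suc a) =
  ↭-trans (↭-prep (c + suc a) (descending-run-↭ c a))
    (↭-trans (∷↭∷ʳ (c + suc a) (applyUpTo (λ p → c + suc p) a))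
             (↭-reflexive (applyUpTo-∷ʳ (λ p → c + suc p) a)))

-- Leader permutations

-- The letter at 0-based position p of the leader permutation of length
-- suc n' with parameter k = m + 2.
opaque
  leaderLetter : ℕ → ℕ → ℕ → ℕ
  leaderLetter n' m p with p ≤? m
  ... | yes _ = suc m ∸ p
  ... | no _ = suc n' + suc m ∸ p

leaderWord : (n' m : ℕ) → Word (suc n')
leaderWord n' m = tabulate (λ i → leaderLetter n' m (toℕ i))

module Leader (n' m : ℕ) (m+2≤n : suc (suc m) ≤ suc n') where

  n : ℕ
  n = suc n'

  letter : ℕ → ℕ
  letter = leaderLetter n' m

  m<n : m < n
  m<n = <-trans (n<1+n m) m+2≤n

  block : ∀ p → p ≤ m ⊎ m < p
  block p with p ≤? m
  ... | yes p≤m = inj₁ p≤m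
  ... | no p≰m = inj₂ (≰⇒> p≰m)

  opaque
    unfolding leaderLetter

    letter-low : ∀ {p} → p ≤ m → letter p ≡ suc m ∸ p
    letter-low {p} p≤m with p ≤? m
    ... | yes _ = refl
    ... | no p≰m = ⊥-elim (p≰m p≤m)

    letter-high : ∀ {p} → m < p → letter p ≡ n + suc m ∸ p
    letter-high {p} m<p with p ≤? m
    ... | yes p≤m = ⊥-elim (<⇒≱ m<p p≤m)
    ... | no _ = refl

  letter+pos-low : ∀ {p} → p ≤ m → letter p + p ≡ suc m
  letter+pos-low p≤m = trans (cong (_+ _) (letter-low p≤m)) (m∸n+n≡m (m≤n⇒m≤1+n p≤m))

  letter+pos-high : ∀ {p} → m < p → p < n → letter p + p ≡ n + suc m
  letter+pos-high {p} m<p p<n =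
    trans (cong (_+ p) (letter-high m<p)) (m∸n+n≡m (≤-trans (<⇒≤ p<n) (m≤m+n n (suc m))))

  letter-of-m : letter m ≡ 1
  letter-of-m = trans (letter-low ≤-refl) (m+n∸n≡m 1 m)

  letter-of-m+1 : letter (suc m) ≡ n
  letter-of-m+1 = trans (letter-high (n<1+n m)) (m+n∸n≡m n (suc m))

  letter-antitone-low : ∀ {p q} → p < q → q ≤ m → letter q < letter p
  letter-antitone-low p<q q≤m =
    sum-constant⇒antitone (letter+pos-low (≤-trans (<⇒≤ p<q) q≤m)) (letter+pos-low q≤m) p<q

  letter-antitone-high : ∀ {p q} → m < p → p < q → q < n → letter q < letter p
  letter-antitone-high m<p p<q q<n =
    sum-constant⇒antitone (letter+pos-high m<p (<-trans p<q q<n))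
                          (letter+pos-high (<-trans m<p p<q) q<n) p<q

  letter-low<high : ∀ {p q} → p ≤ m → m < q → q < n → letter p < letter q
  letter-low<high {p} {q} p≤m m<q q<n = +-cancelʳ-< q (letter p) (letter q) (begin-strict
    letter p + q     <⟨ +-monoʳ-< (letter p) q<n ⟩
    letter p + n     ≤⟨ +-monoˡ-≤ n (m≤m+n (letter p) p) ⟩
    letter p + p + n ≡⟨ cong (_+ n) (letter+pos-low p≤m) ⟩
    suc m + n        ≡⟨ +-comm (suc m) n ⟩
    n + suc m        ≡⟨ letter+pos-high m<q q<n ⟨
    letter q + q     ∎)
    where open ≤-Reasoning

  ascent⇒crosses-blocks : ∀ {p q} → p < q → q < n → letter p < letter q → p ≤ m × m < q
  ascent⇒crosses-blocks {p} {q} p<q q<n asc with block p | block q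
  ... | _ | inj₁ q≤m = ⊥-elim (<-asym asc (letter-antitone-low p<q q≤m))
  ... | inj₂ m<p | inj₂ _ = ⊥-elim (<-asym asc (letter-antitone-high m<p p<q q<n))
  ... | inj₁ p≤m | inj₂ m<q = p≤m , m<q

  avoids123 : ∀ {p q r} → p < q → q < r → r < n → letter p < letter q → letter q < letter r → ⊥
  avoids123 p<q q<r r<n pq qr =
    <-irrefl refl (<-≤-trans (proj₂ (ascent⇒crosses-blocks p<q (<-trans q<r r<n) pq))
                             (proj₁ (ascent⇒crosses-blocks q<r r<n qr)))

  avoids312 : ∀ {p q r} → p < q → q < r → r < n → letter q < letter r → letter r < letter p → ⊥
  avoids312 p<q q<r r<n qr rp with ascent⇒crosses-blocks q<r r<n qr
  ... | q≤m , m<r = <-asym rp (letter-low<high (≤-trans (<⇒≤ p<q) q≤m) m<r r<n)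

  avoids231 : ∀ {p q r} → p < q → q < r → r < n → letter r < letter p → letter p < letter q → ⊥
  avoids231 p<q q<r r<n rp pq with ascent⇒crosses-blocks p<q (<-trans q<r r<n) pq
  ... | p≤m , m<q = <-asym rp (letter-low<high p≤m (<-trans m<q q<r) r<n)

  letter-<⇒≢ : ∀ {p q} → p < q → q < n → letter p ≢ letter q
  letter-<⇒≢ {p} {q} p<q q<n with block p | block q
  ... | _ | inj₁ q≤m = ≢-sym (<⇒≢ (letter-antitone-low p<q q≤m))
  ... | inj₁ p≤m | inj₂ m<q = <⇒≢ (letter-low<high p≤m m<q q<n)
  ... | inj₂ m<p | inj₂ _ = ≢-sym (<⇒≢ (letter-antitone-high m<p p<q q<n))

  letter-injective : ∀ {p q} → p < n → q < n → letter p ≡ letter q → p ≡ q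
  letter-injective {p} {q} p<n q<n eq with <-cmp p q
  ... | tri< p<q _ _ = ⊥-elim (letter-<⇒≢ p<q q<n eq)
  ... | tri≈ _ p≡q _ = p≡q
  ... | tri> _ _ q<p = ⊥-elim (letter-<⇒≢ q<p p<n (sym eq))

  letter≡n⇒pos≡m+1 : ∀ {p} → p < n → letter p ≡ n → p ≡ suc m
  letter≡n⇒pos≡m+1 p<n eq = letter-injective p<n m+2≤n (trans eq (sym letter-of-m+1))

  letter≡1⇒pos≡m : ∀ {p} → p < n → letter p ≡ 1 → p ≡ m
  letter≡1⇒pos≡m p<n eq = letter-injective p<n m<n (trans eq (sym letter-of-m))

  letter-positive : ∀ {p} → p < n → 0 < letter p
  letter-positive {p} p<n with block p
  ... | inj₁ p≤m = subst (0 <_) (sym (letter-low p≤m)) (m<n⇒0<n∸m (s≤s p≤m))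
  ... | inj₂ m<p =
    subst (0 <_) (sym (letter-high m<p)) (m<n⇒0<n∸m (<-≤-trans p<n (m≤m+n n (suc m))))

  letter≤n : ∀ {p} → p < n → letter p ≤ n
  letter≤n {p} p<n with block p
  ... | inj₁ p≤m = subst (_≤ n) (sym (letter-low p≤m)) (≤-trans (m∸n≤m (suc m) p) (<⇒≤ m+2≤n))
  ... | inj₂ m<p = subst (_≤ n) (sym (letter-high m<p))
                         (subst (n + suc m ∸ p ≤_) (m+n∸n≡m n (suc m)) (∸-monoʳ-≤ (n + suc m) m<p))

  letter-distance : ∀ {p t} → p + t < n →
    ∣ letter p - letter (p + t) ∣ ≡ t ⊎ ∣ letter p - letter (p + t) ∣ + t ≡ n
  letter-distance {p} {t} q<n with block p | block (p + t)
  ... | inj₁ p≤m | inj₁ q≤m =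
    inj₁ (sums-equal⇒distance {letter p} {letter (p + t)} (letter+pos-low p≤m) (letter+pos-low q≤m))
  ... | inj₂ m<p | inj₂ m<q =
    inj₁ (sums-equal⇒distance {letter p} {letter (p + t)}
                              (letter+pos-high m<p (≤-<-trans (m≤m+n p t) q<n)) (letter+pos-high m<q q<n))
  ... | inj₂ m<p | inj₁ q≤m = ⊥-elim (<⇒≱ m<p (≤-trans (m≤m+n p t) q≤m))
  ... | inj₁ p≤m | inj₂ m<q with m≤n⇒∃[o]m+o≡n (<⇒≤ (letter-low<high p≤m m<q q<n))
  ...   | s , letter-p+s≡letter-q =
    inj₂ (trans (cong (_+ t) δ≡s) (+-cancelʳ-≡ (letter p + p) (s + t) n (begin
      s + t + (letter p + p)    ≡⟨ rearrange (letter p) s p t ⟩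
      letter p + s + (p + t)    ≡⟨ cong (_+ (p + t)) letter-p+s≡letter-q ⟩
      letter (p + t) + (p + t)  ≡⟨ letter+pos-high m<q q<n ⟩
      n + suc m                 ≡⟨ cong (n +_) (letter+pos-low p≤m) ⟨
      n + (letter p + p)        ∎)))
    where
    open ≡-Reasoning
    δ≡s : ∣ letter p - letter (p + t) ∣ ≡ s
    δ≡s = trans (cong (λ z → ∣ letter p - z ∣) (sym letter-p+s≡letter-q)) (∣m-m+n∣≡n (letter p) s)
    rearrange : ∀ a s p t → s + t + (a + p) ≡ a + s + (p + t)
    rearrange = solve-∀

  distance-avoidsEnds⇒gap : ∀ {p q} → p < q → q < n → AvoidsEnds n' ∣ letter p - letter q ∣ →
                            suc p < q × ¬ (p ≡ 0 × q ≡ n')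
  distance-avoidsEnds⇒gap {p} p<q q<n avoids with m≤n⇒∃[o]m+o≡n (<⇒≤ p<q)
  ... | t , refl = avoidsEnds⇒gap (+-cancelˡ-< p 0 t (subst (_< p + t) (sym (+-identityʳ p)) p<q))
                                  (Equivalence.to (avoidsEnds-transfer (letter-distance q<n)) avoids)

  gap⇒distance-avoidsEnds : ∀ {p q} → p < q → q < n → suc p < q → ¬ (p ≡ 0 × q ≡ n') →
                            AvoidsEnds n' ∣ letter p - letter q ∣
  gap⇒distance-avoidsEnds {p} p<q q<n gap ¬first-last with m≤n⇒∃[o]m+o≡n (<⇒≤ p<q)
  ... | t , refl = Equivalence.from (avoidsEnds-transfer (letter-distance q<n))
                                    (gap⇒avoidsEnds p q<n gap ¬first-last)

  -- The letters at any three positions of a 1234 or 3412 occurrence form a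
  -- 123, 231 or 312, which the leader word avoids.
  ¬Pattern-fixing-abc : ∀ {a b c D} → a < b → b < c → c < n →
                        ¬ Pattern (letter a) (letter b) (letter c) D
  ¬Pattern-fixing-abc a<b b<c c<n (inj₁ (x , y , _)) = avoids123 a<b b<c c<n x y
  ¬Pattern-fixing-abc a<b b<c c<n (inj₂ (x , y , z)) = avoids231 a<b b<c c<n (<-trans x y) z

  ¬Pattern-fixing-abd : ∀ {a b C d} → a < b → b < d → d < n →
                        ¬ Pattern (letter a) (letter b) C (letter d)
  ¬Pattern-fixing-abd a<b b<d d<n (inj₁ (x , y , z)) = avoids123 a<b b<d d<n x (<-trans y z)
  ¬Pattern-fixing-abd a<b b<d d<n (inj₂ (_ , y , z)) = avoids231 a<b b<d d<n y z

  ¬Pattern-fixing-acd : ∀ {a B c d} → a < c → c < d → d < n →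
                        ¬ Pattern (letter a) B (letter c) (letter d)
  ¬Pattern-fixing-acd a<c c<d d<n (inj₁ (x , y , z)) = avoids123 a<c c<d d<n (<-trans x y) z
  ¬Pattern-fixing-acd a<c c<d d<n (inj₂ (x , y , _)) = avoids312 a<c c<d d<n x y

  ¬Pattern-fixing-bcd : ∀ {A b c d} → b < c → c < d → d < n →
                        ¬ Pattern A (letter b) (letter c) (letter d)
  ¬Pattern-fixing-bcd b<c c<d d<n (inj₁ (_ , y , z)) = avoids123 b<c c<d d<n y z
  ¬Pattern-fixing-bcd b<c c<d d<n (inj₂ (x , y , z)) = avoids312 b<c c<d d<n x (<-trans y z)

  module _ {a b c d} (a<b : a < b) (b<c : b < c) (c<d : c < d) (d<n : d < n) where

    ¬Pattern-swapping-ab : ¬ Pattern (letter b) (letter a) (letter c) (letter d)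
    ¬Pattern-swapping-ab (inj₁ (_ , y , z)) = avoids123 (<-trans a<b b<c) c<d d<n y z
    ¬Pattern-swapping-ab (inj₂ (x , y , _)) = avoids312 b<c c<d d<n x y

    ¬Pattern-swapping-cd : ¬ Pattern (letter a) (letter b) (letter d) (letter c)
    ¬Pattern-swapping-cd (inj₁ (x , y , _)) = avoids123 a<b (<-trans b<c c<d) d<n x y
    ¬Pattern-swapping-cd (inj₂ (_ , y , z)) = avoids231 a<b b<c (<-trans c<d d<n) y z

    ¬Pattern-swapping-ad : ¬ Pattern (letter d) (letter b) (letter c) (letter a)
    ¬Pattern-swapping-ad (inj₁ (_ , y , z)) = avoids312 a<b b<c (<-trans c<d d<n) y z
    ¬Pattern-swapping-ad (inj₂ (x , y , z)) = avoids231 a<b b<c (<-trans c<d d<n) x (<-trans y z)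

    ¬Pattern-swapping-bc : ¬ Pattern (letter a) (letter c) (letter b) (letter d)
    ¬Pattern-swapping-bc (inj₁ (x , y , z)) = avoids123 (<-trans a<b b<c) c<d d<n x (<-trans y z)
    ¬Pattern-swapping-bc (inj₂ (x , y , _)) = avoids312 a<b (<-trans b<c c<d) d<n x y

  lookup-leaderWord : ∀ x → lookup (leaderWord n' m) x ≡ letter (toℕ x)
  lookup-leaderWord = lookup∘tabulate (λ i → letter (toℕ i))

  leaderWord-isLeader : LeaderWith n (suc (suc m)) (leaderWord n' m)
  leaderWord-isLeader = s≤s (s≤s z≤n) , m+2≤n , λ i →
    (λ i+1<k → trans (lookup-leaderWord i) (letter-low (≤-pred (≤-pred i+1<k)))) ,
    (λ k≤i+1 → trans (lookup-leaderWord i)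
                     (trans (letter-high (≤-pred k≤i+1)) (sym (cong (_∸ toℕ i) (+-suc n' (suc m))))))

  leaderWith⇒≡leaderWord : ∀ v → LeaderWith n (suc (suc m)) v → v ≡ leaderWord n' m
  leaderWith⇒≡leaderWord v (_ , _ , entries) =
    lookup-ext (λ x → trans (entry x) (sym (lookup-leaderWord x)))
    where
    entry : ∀ x → lookup v x ≡ letter (toℕ x)
    entry x with block (toℕ x)
    ... | inj₁ x≤m = trans (proj₁ (entries x) (s≤s (s≤s x≤m))) (sym (letter-low x≤m))
    ... | inj₂ m<x = trans (proj₂ (entries x) (s≤s m<x))
                           (trans (cong (_∸ toℕ x) (+-suc n' (suc m))) (sym (letter-high m<x)))

  letter-upper-run : ∀ {p} → p < n ∸ suc m → letter (suc m + p) ≡ suc m + (n ∸ suc m ∸ p)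
  letter-upper-run {p} p<r = begin
    letter (suc m + p)        ≡⟨ letter-high (s≤s (m≤m+n m p)) ⟩
    n + suc m ∸ (suc m + p)   ≡⟨ cong (_∸ (suc m + p)) (+-comm n (suc m)) ⟩
    suc m + n ∸ (suc m + p)   ≡⟨ [m+n]∸[m+o]≡n∸o (suc m) n p ⟩
    n ∸ p                     ≡⟨ cong (_∸ p) (m+[n∸m]≡n (<⇒≤ m+2≤n)) ⟨
    suc m + (n ∸ suc m) ∸ p   ≡⟨ +-∸-assoc (suc m) (<⇒≤ p<r) ⟩
    suc m + (n ∸ suc m ∸ p)   ∎
    where open ≡-Reasoning

  leaderWord-isPerm : IsPerm n (leaderWord n' m)
  leaderWord-isPerm = begin
    toList (leaderWord n' m)
      ≡⟨ toList∘tabulate n letter ⟩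
    applyUpTo letter n
      ≡⟨ cong (applyUpTo letter) m+1+r≡n ⟨
    applyUpTo letter (suc m + r)
      ≡⟨ applyUpTo-++ letter (suc m) r ⟩
    applyUpTo letter (suc m) ++ applyUpTo (λ p → letter (suc m + p)) r
      ≡⟨ cong₂ _++_ (applyUpTo-cong _ _ (suc m) (λ p p<m+1 → letter-low (≤-pred p<m+1)))
                    (applyUpTo-cong _ _ r (λ _ → letter-upper-run)) ⟩
    applyUpTo (λ p → suc m ∸ p) (suc m) ++ applyUpTo (λ p → suc m + (r ∸ p)) r
      ↭⟨ ++⁺ (descending-run-↭ 0 (suc m)) (descending-run-↭ (suc m) r) ⟩
    applyUpTo suc (suc m) ++ applyUpTo (λ p → suc m + suc p) r
      ≡⟨ cong (applyUpTo suc (suc m) ++_) (applyUpTo-cong _ _ r (λ p _ → +-suc (suc m) p)) ⟩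
    applyUpTo suc (suc m) ++ applyUpTo (λ p → suc (suc m + p)) r
      ≡⟨ applyUpTo-++ suc (suc m) r ⟨
    applyUpTo suc (suc m + r)
      ≡⟨ cong (applyUpTo suc) m+1+r≡n ⟩
    applyUpTo suc n
      ≡⟨ map-upTo suc n ⟨
    List.map suc (upTo n)
      ∎
    where
    open PermutationReasoning
    r : ℕ
    r = n ∸ suc m
    m+1+r≡n : suc m + r ≡ n
    m+1+r≡n = m+[n∸m]≡n (<⇒≤ m+2≤n)

-- Permutations adjacent to a leader permutation

AdjacencyClassOf : (n : ℕ) → Word n → Set
AdjacencyClassOf n π =
  Σ[ ρ ∈ Word n ] (IsPerm n ρ × ((σ : Word n) → IsPerm n σ → (Adjacent n π σ ⇔ Equiv n ρ σ)))

module Adjacency (n' m : ℕ) (m+2≤n : suc (suc m) ≤ suc n') where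

  open Leader n' m m+2≤n

  π : Word n
  π = leaderWord n' m

  π[_↔_] : Fin n → Fin n → Word n
  π[ p ↔ q ] = swapAt π p q

  -- Positions x < y whose transposition in π swaps two letters differing by
  -- neither 1 nor n - 1 (first two fields) and puts neither n first nor 1 last.
  record Admissible (x y : ℕ) : Set where
    constructor admissible
    field
      gap         : suc x < y
      ¬first-last : ¬ (x ≡ 0 × y ≡ n')
      ¬n-first    : ¬ (x ≡ 0 × y ≡ suc m)
      ¬1-last     : ¬ (x ≡ m × y ≡ n')

  AdmissibleTransposition : Word n → Set
  AdmissibleTransposition σ =
    Σ[ p ∈ Fin n ] Σ[ q ∈ Fin n ] (Admissible (toℕ p) (toℕ q) × σ ≡ π[ p ↔ q ])

  lookup-π[↔]ˡ : ∀ p q → lookup π[ p ↔ q ] p ≡ letter (toℕ q)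
  lookup-π[↔]ˡ p q = trans (lookup∘swapAtˡ π p q) (lookup-leaderWord q)

  lookup-π[↔]ʳ : ∀ p q → lookup π[ p ↔ q ] q ≡ letter (toℕ p)
  lookup-π[↔]ʳ p q = trans (lookup∘swapAtʳ π p q) (lookup-leaderWord p)

  lookup-π[↔]′ : ∀ p q x → x ≢ p → x ≢ q → lookup π[ p ↔ q ] x ≡ letter (toℕ x)
  lookup-π[↔]′ p q x x≢p x≢q = trans (lookup∘swapAt′ π p q x x≢p x≢q) (lookup-leaderWord x)

  m<n' : m < n'
  m<n' = ≤-pred m+2≤n

  π-¬beginsWithN : ¬ BeginsWithN n π
  π-¬beginsWithN (i , i≡0 , πi≡n) =
    0≢1+n (trans (sym i≡0) (letter≡n⇒pos≡m+1 (toℕ<n i) (trans (sym (lookup-leaderWord i)) πi≡n)))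

  π-¬endsWith1 : ¬ EndsWith1 n π
  π-¬endsWith1 (i , i≡n' , πi≡1) =
    <-irrefl (trans (sym (letter≡1⇒pos≡m (toℕ<n i) (trans (sym (lookup-leaderWord i)) πi≡1))) i≡n') m<n'

  admissible⇒adjacent : ∀ {p q} → Admissible (toℕ p) (toℕ q) → Adjacent n π π[ p ↔ q ]
  admissible⇒adjacent {p} {q} (admissible gap ¬first-last ¬n-first ¬1-last) =
    π-¬beginsWithN , π-¬endsWith1 , ¬beginsWithN , ¬endsWith1 , p , q , letters-≢ ,
    proj₁ distance-avoidsEnds , proj₂ distance-avoidsEnds , sym (swapAt-involutive π p q)
    where
    p<q : toℕ p < toℕ q
    p<q = <-trans (n<1+n _) gap
    q<n = toℕ<n q
    ¬beginsWithN : ¬ BeginsWithN n π[ p ↔ q ]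
    ¬beginsWithN (i , i≡0 , σi≡n) with i ≟ᶠ q | i ≟ᶠ p
    ... | yes refl | _ = n≮0 (subst (toℕ p <_) i≡0 p<q)
    ... | no _ | yes refl =
      ¬n-first (i≡0 , letter≡n⇒pos≡m+1 q<n (trans (sym (lookup-π[↔]ˡ i q)) σi≡n))
    ... | no i≢q | no i≢p =
      0≢1+n (trans (sym i≡0)
                   (letter≡n⇒pos≡m+1 (toℕ<n i) (trans (sym (lookup-π[↔]′ p q i i≢p i≢q)) σi≡n)))
    ¬endsWith1 : ¬ EndsWith1 n π[ p ↔ q ]
    ¬endsWith1 (i , i≡n' , σi≡1) with i ≟ᶠ q | i ≟ᶠ p
    ... | yes refl | _ =
      ¬1-last (letter≡1⇒pos≡m (toℕ<n p) (trans (sym (lookup-π[↔]ʳ p i)) σi≡1) , i≡n')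
    ... | no _ | yes refl = <⇒≱ (subst (_< toℕ q) i≡n' p<q) (≤-pred q<n)
    ... | no i≢q | no i≢p =
      <-irrefl (trans (sym (letter≡1⇒pos≡m (toℕ<n i) (trans (sym (lookup-π[↔]′ p q i i≢p i≢q)) σi≡1)))
                      i≡n')
               m<n'
    swapped-distance : ∣ lookup π[ p ↔ q ] p - lookup π[ p ↔ q ] q ∣ ≡ ∣ letter (toℕ p) - letter (toℕ q) ∣
    swapped-distance =
      trans (cong₂ ∣_-_∣ (lookup-π[↔]ˡ p q) (lookup-π[↔]ʳ p q)) (∣-∣-comm (letter (toℕ q)) _)
    letters-≢ : lookup π[ p ↔ q ] p ≢ lookup π[ p ↔ q ] q
    letters-≢ eq =
      letter-<⇒≢ p<q q<n (sym (trans (sym (lookup-π[↔]ˡ p q)) (trans eq (lookup-π[↔]ʳ p q))))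
    distance-avoidsEnds : AvoidsEnds n' ∣ lookup π[ p ↔ q ] p - lookup π[ p ↔ q ] q ∣
    distance-avoidsEnds =
      subst (AvoidsEnds n') (sym swapped-distance) (gap⇒distance-avoidsEnds p<q q<n gap ¬first-last)

  ordered⇒admissible : ∀ {σ p q} → toℕ p < toℕ q → σ ≡ π[ p ↔ q ] →
                       AvoidsEnds n' ∣ letter (toℕ p) - letter (toℕ q) ∣ →
                       ¬ BeginsWithN n σ → ¬ EndsWith1 n σ → Admissible (toℕ p) (toℕ q)
  ordered⇒admissible {p = p} {q} p<q refl avoids ¬beginsWithN ¬endsWith1 =
    admissible (proj₁ gap) (proj₂ gap)
      (λ (p≡0 , q≡m+1) →
        ¬beginsWithN (p , p≡0 , trans (lookup-π[↔]ˡ p q) (trans (cong letter q≡m+1) letter-of-m+1)))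
      (λ (p≡m , q≡n') →
        ¬endsWith1 (q , q≡n' , trans (lookup-π[↔]ʳ p q) (trans (cong letter p≡m) letter-of-m)))
    where
    gap = distance-avoidsEnds⇒gap p<q (toℕ<n q) avoids

  adjacent⇒admissible : ∀ {σ} → Adjacent n π σ → AdmissibleTransposition σ
  adjacent⇒admissible {σ} (_ , _ , ¬beginsWithN , ¬endsWith1 , i , j , letters-≢ , δ≢1 , δ≢n' , π≡σ[i↔j]) =
    by-order (<-cmp (toℕ i) (toℕ j))
    where
    σ≡π[i↔j] : σ ≡ π[ i ↔ j ]
    σ≡π[i↔j] = trans (sym (swapAt-involutive σ i j)) (cong (λ w → swapAt w i j) (sym π≡σ[i↔j]))
    avoids : AvoidsEnds n' ∣ letter (toℕ j) - letter (toℕ i) ∣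
    avoids = subst (AvoidsEnds n')
                   (cong₂ ∣_-_∣ (trans (cong (λ w → lookup w i) σ≡π[i↔j]) (lookup-π[↔]ˡ i j))
                                (trans (cong (λ w → lookup w j) σ≡π[i↔j]) (lookup-π[↔]ʳ i j)))
                   (δ≢1 , δ≢n')
    by-order : Tri (toℕ i < toℕ j) (toℕ i ≡ toℕ j) (toℕ j < toℕ i) → AdmissibleTransposition σ
    by-order (tri< i<j _ _) =
      i , j , ordered⇒admissible i<j σ≡π[i↔j] (subst (AvoidsEnds n') (∣-∣-comm (letter (toℕ j)) _) avoids)
                                 ¬beginsWithN ¬endsWith1 ,
      σ≡π[i↔j]
    by-order (tri≈ _ i≡j _) = ⊥-elim (letters-≢ (cong (lookup σ) (toℕ-injective i≡j)))
    by-order (tri> _ _ j<i) =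
      j , i , ordered⇒admissible j<i σ≡π[j↔i] avoids ¬beginsWithN ¬endsWith1 , σ≡π[j↔i]
      where
      σ≡π[j↔i] : σ ≡ π[ j ↔ i ]
      σ≡π[j↔i] = trans σ≡π[i↔j] (swapAt-sym π i j)

  admissibleTransposition⇒adjacent : ∀ {σ} → AdmissibleTransposition σ → Adjacent n π σ
  admissibleTransposition⇒adjacent (_ , _ , adm , refl) = admissible⇒adjacent adm

  lookup-untouched : ∀ {p q x} → Untouched p q x → lookup π[ p ↔ q ] x ≡ letter (toℕ x)
  lookup-untouched {p} {q} (x≢p , x≢q) = lookup-π[↔]′ p q _ x≢p x≢q

  lookup-touchedˡ : ∀ {p q x y} → x ≡ p → y ≡ q → lookup π[ p ↔ q ] x ≡ letter (toℕ y)
  lookup-touchedˡ {p} {q} refl refl = lookup-π[↔]ˡ p q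

  lookup-touchedʳ : ∀ {p q x y} → x ≡ p → y ≡ q → lookup π[ p ↔ q ] y ≡ letter (toℕ x)
  lookup-touchedʳ {p} {q} refl refl = lookup-π[↔]ʳ p q

  Occurrence : Word n → Fin n → Fin n → Fin n → Fin n → Set
  Occurrence v a b c d = Pattern (lookup v a) (lookup v b) (lookup v c) (lookup v d)

  occurrence-touches-ac-or-bd :
    ∀ {p q a b c d} → toℕ p < toℕ q → toℕ a < toℕ b → toℕ b < toℕ c → toℕ c < toℕ d →
    Occurrence π[ p ↔ q ] a b c d → (a ≡ p × c ≡ q ⊎ b ≡ p × d ≡ q) × letter (toℕ c) < letter (toℕ b)
  occurrence-touches-ac-or-bd {p} {q} {a} {b} {c} {d} p<q a<b b<c c<d pat =
    cases (touched? p q a) (touched? p q b) (touched? p q c) (touched? p q d)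
    where
    d<n = toℕ<n d
    c<n = <-trans c<d d<n
    a<c = <-trans a<b b<c
    b<d = <-trans b<c c<d
    fixed = lookup-untouched
    swappedˡ = lookup-touchedˡ
    swappedʳ = lookup-touchedʳ
    cases : Touched p q a ⊎ Untouched p q a → Touched p q b ⊎ Untouched p q b →
            Touched p q c ⊎ Untouched p q c → Touched p q d ⊎ Untouched p q d →
            (a ≡ p × c ≡ q ⊎ b ≡ p × d ≡ q) × letter (toℕ c) < letter (toℕ b)
    cases (inj₂ ua) (inj₂ ub) (inj₂ uc) _ =
      ⊥-elim (¬Pattern-fixing-abc a<b b<c c<n (Pattern-cong (fixed ua) (fixed ub) (fixed uc) refl pat))
    cases (inj₁ _) (inj₂ ub) (inj₂ uc) (inj₂ ud) =
      ⊥-elim (¬Pattern-fixing-bcd b<c c<d d<n (Pattern-cong refl (fixed ub) (fixed uc) (fixed ud) pat))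
    cases (inj₂ ua) (inj₁ _) (inj₂ uc) (inj₂ ud) =
      ⊥-elim (¬Pattern-fixing-acd a<c c<d d<n (Pattern-cong (fixed ua) refl (fixed uc) (fixed ud) pat))
    cases (inj₂ ua) (inj₂ ub) (inj₁ _) (inj₂ ud) =
      ⊥-elim (¬Pattern-fixing-abd a<b b<d d<n (Pattern-cong (fixed ua) (fixed ub) refl (fixed ud) pat))
    cases (inj₁ ta) (inj₁ tb) (inj₂ uc) (inj₂ ud) with touched-pair p<q a<b ta tb
    ... | ap , bq = ⊥-elim (¬Pattern-swapping-ab a<b b<c c<d d<n
                             (Pattern-cong (swappedˡ ap bq) (swappedʳ ap bq) (fixed uc) (fixed ud) pat))
    cases (inj₂ ua) (inj₂ ub) (inj₁ tc) (inj₁ td) with touched-pair p<q c<d tc td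
    ... | cp , dq = ⊥-elim (¬Pattern-swapping-cd a<b b<c c<d d<n
                             (Pattern-cong (fixed ua) (fixed ub) (swappedˡ cp dq) (swappedʳ cp dq) pat))
    cases (inj₁ ta) (inj₂ ub) (inj₂ uc) (inj₁ td) with touched-pair p<q (<-trans a<b b<d) ta td
    ... | ap , dq = ⊥-elim (¬Pattern-swapping-ad a<b b<c c<d d<n
                             (Pattern-cong (swappedˡ ap dq) (fixed ub) (fixed uc) (swappedʳ ap dq) pat))
    cases (inj₂ ua) (inj₁ tb) (inj₁ tc) (inj₂ ud) with touched-pair p<q b<c tb tc
    ... | bp , cq = ⊥-elim (¬Pattern-swapping-bc a<b b<c c<d d<n
                             (Pattern-cong (fixed ua) (swappedˡ bp cq) (swappedʳ bp cq) (fixed ud) pat))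
    cases (inj₁ ta) (inj₂ ub) (inj₁ tc) (inj₂ _) with touched-pair p<q a<c ta tc
    ... | ap , cq = inj₁ (ap , cq) , subst₂ _<_ (swappedˡ ap cq) (fixed ub) (Pattern-A<B pat)
    cases (inj₂ _) (inj₁ tb) (inj₂ uc) (inj₁ td) with touched-pair p<q b<d tb td
    ... | bp , dq = inj₂ (bp , dq) , subst₂ _<_ (fixed uc) (swappedʳ bp dq) (Pattern-C<D pat)
    cases (inj₁ ta) (inj₁ tb) (inj₁ tc) _ = ⊥-elim (¬touched-three p<q a<b b<c ta tb tc)
    cases (inj₁ ta) (inj₁ tb) (inj₂ _) (inj₁ td) = ⊥-elim (¬touched-three p<q a<b b<d ta tb td)
    cases (inj₁ ta) (inj₂ _) (inj₁ tc) (inj₁ td) = ⊥-elim (¬touched-three p<q a<c c<d ta tc td)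
    cases (inj₂ _) (inj₁ tb) (inj₁ tc) (inj₁ td) = ⊥-elim (¬touched-three p<q b<c c<d tb tc td)

  replStep-touching-ac : ∀ {p q a b c d w} → a ≡ p → c ≡ q →
                         toℕ a < toℕ b → toℕ b < toℕ c → toℕ c < toℕ d → letter (toℕ c) < letter (toℕ b) →
                         w ≡ swapAt (swapAt π[ p ↔ q ] a c) b d → AdmissibleTransposition w
  replStep-touching-ac {p} {q} {b = b} {d = d} refl refl a<b b<c c<d c<b-letters w≡ =
    b , d , admissible (≤-<-trans b<c c<d) b≢0 b≢0 ¬1-last ,
    trans w≡ (cong (λ u → swapAt u b d) (swapAt-involutive π p q))
    where
    b≢0 : ∀ {P : Set} → ¬ (toℕ b ≡ 0 × P)
    b≢0 (b≡0 , _) = n≮0 (subst (toℕ p <_) b≡0 a<b)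
    ¬1-last : ¬ (toℕ b ≡ m × toℕ d ≡ n')
    ¬1-last (b≡m , _) =
      <⇒≱ (letter-positive (toℕ<n q))
          (≤-pred (subst (letter (toℕ q) <_) (trans (cong letter b≡m) letter-of-m) c<b-letters))

  replStep-touching-bd : ∀ {p q a b c d w} → b ≡ p → d ≡ q →
                         toℕ a < toℕ b → toℕ b < toℕ c → toℕ c < toℕ d → letter (toℕ c) < letter (toℕ b) →
                         w ≡ swapAt (swapAt π[ p ↔ q ] a c) b d → AdmissibleTransposition w
  replStep-touching-bd {p} {q} {a} {c = c} refl refl a<b b<c c<d c<b-letters w≡ =
    a , c , admissible (≤-<-trans a<b b<c) c≢n' ¬n-first c≢n' ,
    trans w≡ (swapAt-cancel-across π p q a c (<⇒≢ᶠ a<b) (<⇒≢ᶠ (<-trans a<b (<-trans b<c c<d)))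
                                             (≢-sym (<⇒≢ᶠ b<c)) (<⇒≢ᶠ c<d))
    where
    c≢n' : ∀ {P : Set} → ¬ (P × toℕ c ≡ n')
    c≢n' (_ , c≡n') = <⇒≱ (subst (_< toℕ q) c≡n' c<d) (≤-pred (toℕ<n q))
    ¬n-first : ¬ (toℕ a ≡ 0 × toℕ c ≡ suc m)
    ¬n-first (_ , c≡m+1) =
      <⇒≱ (subst (_< letter (toℕ p)) (trans (cong letter c≡m+1) letter-of-m+1) c<b-letters)
          (letter≤n (toℕ<n p))

  replStep-preserves-admissible : ∀ {p q w} → Admissible (toℕ p) (toℕ q) → ReplStep n π[ p ↔ q ] w →
                                  AdmissibleTransposition w
  replStep-preserves-admissible adm (a , b , c , d , a<b , b<c , c<d , pat , w≡)
    with occurrence-touches-ac-or-bd (<-trans (n<1+n _) (Admissible.gap adm)) a<b b<c c<d pat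
  ... | inj₁ (a≡p , c≡q) , c<b-letters = replStep-touching-ac a≡p c≡q a<b b<c c<d c<b-letters w≡
  ... | inj₂ (b≡p , d≡q) , c<b-letters = replStep-touching-bd b≡p d≡q a<b b<c c<d c<b-letters w≡

  adjacent-replStep : ∀ {σ w} → Adjacent n π σ → ReplStep n σ w → Adjacent n π w
  adjacent-replStep adj step with adjacent⇒admissible adj
  ... | _ , _ , adm , refl = admissibleTransposition⇒adjacent (replStep-preserves-admissible adm step)

  adjacent-equiv : ∀ {σ w} → Adjacent n π σ → Equiv n σ w → Adjacent n π w
  adjacent-equiv adj ε = adj
  adjacent-equiv adj (step ◅ steps) = adjacent-equiv (adjacent-replStep adj step) steps

  π[↔]-isPerm : ∀ p q → IsPerm n π[ p ↔ q ]
  π[↔]-isPerm p q = ↭-trans (swapAt-↭ π p q) leaderWord-isPerm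

  replStep-between-transpositions :
    ∀ {a b c d} → toℕ a < toℕ b → toℕ b < toℕ c → toℕ c < toℕ d →
    Pattern (letter (toℕ c)) (letter (toℕ b)) (letter (toℕ a)) (letter (toℕ d)) →
    ReplStep n π[ a ↔ c ] π[ b ↔ d ]
  replStep-between-transpositions {a} {b} {c} {d} a<b b<c c<d pat =
    a , b , c , d , a<b , b<c , c<d ,
    Pattern-cong (sym (lookup-π[↔]ˡ a c)) (sym (lookup-π[↔]′ a c b (≢-sym (<⇒≢ᶠ a<b)) (<⇒≢ᶠ b<c)))
                 (sym (lookup-π[↔]ʳ a c)) (sym (lookup-π[↔]′ a c d (≢-sym (<⇒≢ᶠ a<d)) (≢-sym (<⇒≢ᶠ c<d))))
                 pat ,
    cong (λ u → swapAt u b d) (sym (swapAt-involutive π a c))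
    where
    a<d = <-trans a<b (<-trans b<c c<d)

  move-1234 : ∀ {a b c d} → toℕ a < toℕ b → toℕ b < toℕ c → toℕ c ≤ m → m < toℕ d →
              ReplStep n π[ a ↔ c ] π[ b ↔ d ]
  move-1234 {d = d} a<b b<c c≤m m<d =
    replStep-between-transpositions a<b b<c (<-≤-trans (s≤s c≤m) m<d)
      (inj₁ (letter-antitone-low b<c c≤m , letter-antitone-low a<b b≤m , letter-low<high a≤m m<d (toℕ<n d)))
    where
    b≤m = ≤-trans (<⇒≤ b<c) c≤m
    a≤m = ≤-trans (<⇒≤ a<b) b≤m

  move-3412 : ∀ {a b c d} → toℕ a ≤ m → m < toℕ b → toℕ b < toℕ c → toℕ c < toℕ d →
              ReplStep n π[ a ↔ c ] π[ b ↔ d ]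
  move-3412 {d = d} a≤m m<b b<c c<d =
    replStep-between-transpositions (≤-<-trans a≤m m<b) b<c c<d
      (inj₂ (letter-low<high a≤m (<-trans m<b (<-trans b<c c<d)) d<n ,
             letter-antitone-high (<-trans m<b b<c) c<d d<n ,
             letter-antitone-high m<b b<c (<-trans c<d d<n)))
    where
    d<n = toℕ<n d

  -- pos x is a junk value (the last position) when x ≥ n.
  pos : ℕ → Fin n
  pos x = fromℕ< (s≤s (m⊓n≤n x n'))

  toℕ-pos : ∀ {x} → x < n → toℕ (pos x) ≡ x
  toℕ-pos {x} x<n = trans (toℕ-fromℕ< (s≤s (m⊓n≤n x n'))) (m≤n⇒m⊓n≡m (≤-pred x<n))

  pos-toℕ : ∀ i → pos (toℕ i) ≡ i
  pos-toℕ i =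
    trans (fromℕ<-cong (toℕ i ⊓ n') (toℕ i) (m≤n⇒m⊓n≡m (≤-pred (toℕ<n i))) _ (toℕ<n i))
          (fromℕ<-toℕ i (toℕ<n i))

  pos-< : ∀ {x y} → x < y → y < n → toℕ (pos x) < toℕ (pos y)
  pos-< x<y y<n = subst₂ _<_ (sym (toℕ-pos (<-trans x<y y<n))) (sym (toℕ-pos y<n)) x<y

  π⟨_↔_⟩ : ℕ → ℕ → Word n
  π⟨ x ↔ y ⟩ = π[ pos x ↔ pos y ]

  admissible-pos : ∀ {x y} → y < n → Admissible x y → Admissible (toℕ (pos x)) (toℕ (pos y))
  admissible-pos y<n adm =
    subst₂ Admissible (sym (toℕ-pos (<-trans (n<1+n _) (<-trans (Admissible.gap adm) y<n))))
                      (sym (toℕ-pos y<n)) adm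

  move-1234ℕ : ∀ {a b c d} → a < b → b < c → c ≤ m → m < d → d < n →
               ReplStep n π⟨ a ↔ c ⟩ π⟨ b ↔ d ⟩
  move-1234ℕ a<b b<c c≤m m<d d<n =
    move-1234 (pos-< a<b b<n) (pos-< b<c c<n)
              (subst (_≤ m) (sym (toℕ-pos c<n)) c≤m) (subst (m <_) (sym (toℕ-pos d<n)) m<d)
    where
    c<n = ≤-<-trans c≤m m<n
    b<n = <-trans b<c c<n

  move-3412ℕ : ∀ {a b c d} → a ≤ m → m < b → b < c → c < d → d < n →
               ReplStep n π⟨ a ↔ c ⟩ π⟨ b ↔ d ⟩
  move-3412ℕ a≤m m<b b<c c<d d<n =
    move-3412 (subst (_≤ m) (sym (toℕ-pos (≤-<-trans a≤m m<n))) a≤m) (subst (m <_) (sym (toℕ-pos b<n)) m<b)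
              (pos-< b<c c<n) (pos-< c<d d<n)
    where
    c<n = <-trans c<d d<n
    b<n = <-trans b<c c<n

  upper-position-cases : ∀ {y} → m < y → y ≤ n' → y ≡ suc m ⊎ (suc (suc m) ≤ y × y < n') ⊎ y ≡ n'
  upper-position-cases {y} m<y y≤n' with y ≟ suc m | <-cmp y n'
  ... | yes y≡m+1 | _ = inj₁ y≡m+1
  ... | no _ | tri≈ _ y≡n' _ = inj₂ (inj₂ y≡n')
  ... | no _ | tri> _ _ n'<y = ⊥-elim (<⇒≱ n'<y y≤n')
  ... | no y≢m+1 | tri< y<n' _ _ = inj₂ (inj₁ (≤∧≢⇒< m<y (≢-sym y≢m+1) , y<n'))

  edge⇒interior : ∀ {x y} → Admissible x y → x ≤ m → y ≡ suc m ⊎ y ≡ n' → 0 < x × x < m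
  edge⇒interior {zero} adm _ (inj₁ y≡m+1) = ⊥-elim (Admissible.¬n-first adm (refl , y≡m+1))
  edge⇒interior {zero} adm _ (inj₂ y≡n') = ⊥-elim (Admissible.¬first-last adm (refl , y≡n'))
  edge⇒interior {suc x} adm _ (inj₁ refl) = z<s , ≤-pred (Admissible.gap adm)
  edge⇒interior {suc x} adm x≤m (inj₂ y≡n') =
    z<s , ≤∧≢⇒< x≤m (λ x≡m → Admissible.¬1-last adm (x≡m , y≡n'))

  ConnectedTo : Word n → Set
  ConnectedTo hub = ∀ {x y} → y < n → Admissible x y → Star (ReplStep n) π⟨ x ↔ y ⟩ hub

  module UpperHub (m+3≤n' : suc (suc (suc m)) ≤ n') where

    m+2<n : suc (suc m) < n
    m+2<n = <-trans (<-≤-trans (n<1+n _) m+3≤n') (n<1+n n')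

    m+2<n' : suc (suc m) < n'
    m+2<n' = <-≤-trans (n<1+n _) m+3≤n'

    m<m+2 : m < suc (suc m)
    m<m+2 = ≤-<-trans (n≤1+n m) (n<1+n _)

    hub-admissible : Admissible (suc m) n'
    hub-admissible = admissible m+3≤n' (λ ()) (λ ()) (λ (m+1≡m , _) → <-irrefl (sym m+1≡m) (n<1+n m))

    into-hub : ∀ {a c} → a ≤ m → suc (suc m) ≤ c → c < n' → ReplStep n π⟨ a ↔ c ⟩ π⟨ suc m ↔ n' ⟩
    into-hub a≤m m+2≤c c<n' = move-3412ℕ a≤m (n<1+n m) m+2≤c c<n' (n<1+n n')

    from-edge : ∀ {x y} → 0 < x × x < m → m < y → y < n →
                Star (ReplStep n) π⟨ x ↔ y ⟩ π⟨ suc m ↔ n' ⟩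
    from-edge {suc x'} (_ , x<m) m<y y<n =
      replStep-sym (move-1234ℕ (n<1+n x') (n<1+n _) x<m m<y y<n) ◅
      move-1234ℕ (n<1+n x') (n<1+n _) x<m m<m+2 m+2<n ◅
      into-hub (<⇒≤ x<m) ≤-refl m+2<n' ◅ ε

    connected : ConnectedTo π⟨ suc m ↔ n' ⟩
    connected {x} {y} y<n adm with block x
    ... | inj₂ m<x =
      replStep-sym (move-3412ℕ z≤n m<x (n<1+n x) (Admissible.gap adm) y<n) ◅
      into-hub z≤n (s≤s m<x) (<-≤-trans (Admissible.gap adm) (≤-pred y<n)) ◅ ε
    ... | inj₁ x≤m with block y
    ...   | inj₁ y≤m =
      move-1234ℕ (n<1+n x) (Admissible.gap adm) y≤m m<m+2 m+2<n ◅
      into-hub (≤-trans (<⇒≤ (Admissible.gap adm)) y≤m) ≤-refl m+2<n' ◅ ε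
    ...   | inj₂ m<y with upper-position-cases m<y (≤-pred y<n)
    ...     | inj₂ (inj₁ (m+2≤y , y<n')) = into-hub x≤m m+2≤y y<n' ◅ ε
    ...     | inj₁ y≡m+1 = from-edge (edge⇒interior adm x≤m (inj₁ y≡m+1)) m<y y<n
    ...     | inj₂ (inj₂ y≡n') = from-edge (edge⇒interior adm x≤m (inj₂ y≡n')) m<y y<n

  module LowerHub (n'≤m+2 : n' ≤ suc (suc m)) (1<m : 1 < m) where

    hub-admissible : Admissible 0 m
    hub-admissible =
      admissible 1<m (λ (_ , m≡n') → <-irrefl m≡n' m<n') (λ (_ , m≡m+1) → <-irrefl m≡m+1 (n<1+n m))
                     (λ (0≡m , _) → <-irrefl 0≡m (<-trans z<s 1<m))

    from-edge : ∀ {x y} → 0 < x × x < m → m < y → y < n → Star (ReplStep n) π⟨ x ↔ y ⟩ π⟨ 0 ↔ m ⟩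
    from-edge (0<x , x<m) m<y y<n = replStep-sym (move-1234ℕ 0<x x<m ≤-refl m<y y<n) ◅ ε

    from-lower : ∀ {x y} → suc x < y → y ≤ m → Star (ReplStep n) π⟨ x ↔ y ⟩ π⟨ 0 ↔ m ⟩
    from-lower {y = suc y'} x+1<y y≤m =
      move-1234ℕ (≤-pred x+1<y) (n<1+n y') y≤m (n<1+n m) m+2≤n ◅
      replStep-sym (move-1234ℕ (≤-<-trans z≤n (≤-pred x+1<y)) y≤m ≤-refl (n<1+n m) m+2≤n) ◅ ε

    connected : ConnectedTo π⟨ 0 ↔ m ⟩
    connected {x} {y} y<n adm with block x
    ... | inj₂ m<x =
      ⊥-elim (<⇒≱ (≤-<-trans (s≤s m<x) (Admissible.gap adm)) (≤-trans (≤-pred y<n) n'≤m+2))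
    ... | inj₁ x≤m with block y
    ...   | inj₁ y≤m = from-lower (Admissible.gap adm) y≤m
    ...   | inj₂ m<y with upper-position-cases m<y (≤-pred y<n)
    ...     | inj₂ (inj₁ (m+2≤y , y<n')) = ⊥-elim (<⇒≱ (<-≤-trans y<n' n'≤m+2) m+2≤y)
    ...     | inj₁ y≡m+1 = from-edge (edge⇒interior adm x≤m (inj₁ y≡m+1)) m<y y<n
    ...     | inj₂ (inj₂ y≡n') = from-edge (edge⇒interior adm x≤m (inj₂ y≡n')) m<y y<n

  class-of-hub : ∀ {x y} → y < n → Admissible x y → ConnectedTo π⟨ x ↔ y ⟩ → AdjacencyClassOf n π
  class-of-hub {x} {y} y<n adm connected =
    π⟨ x ↔ y ⟩ , π[↔]-isPerm (pos x) (pos y) ,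
    λ σ _ → mk⇔ to (adjacent-equiv (admissible⇒adjacent (admissible-pos y<n adm)))
    where
    to : ∀ {σ} → Adjacent n π σ → Equiv n π⟨ x ↔ y ⟩ σ
    to adj with adjacent⇒admissible adj
    ... | p , q , adm′ , refl =
      reverse replStep-sym
        (subst (λ u → Star (ReplStep n) u π⟨ x ↔ y ⟩) (cong₂ π[_↔_] (pos-toℕ p) (pos-toℕ q))
               (connected (toℕ<n q) adm′))

  adjacency-class : 6 ≤ n' → AdjacencyClassOf n π
  adjacency-class 6≤n' with suc (suc (suc m)) ≤? n'
  ... | yes m+3≤n' = class-of-hub (n<1+n n') hub-admissible connected
    where open UpperHub m+3≤n'
  ... | no m+3≰n' = class-of-hub m<n hub-admissible connected
    where
    n'≤m+2 : n' ≤ suc (suc m)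
    n'≤m+2 = ≤-pred (≰⇒> m+3≰n')
    open LowerHub n'≤m+2 (≤-trans (m≤m+n 2 2) (+-cancelˡ-≤ 2 4 m (≤-trans 6≤n' n'≤m+2)))

-- Distinct leader permutations have distinct adjacency classes

low-sum≢high-sum : ∀ {n' c d} → suc (suc c) ≤ suc n' → suc c ≢ suc n' + suc d
low-sum≢high-sum {n'} {d = d} c+2≤n eq = <⇒≱ c+2≤n (subst (suc n' ≤_) (sym eq) (m≤m+n (suc n') (suc d)))

module _ {n' a b} (a+2≤n : suc (suc a) ≤ suc n') (b+2≤n : suc (suc b) ≤ suc n') where

  private
    module A = Leader n' a a+2≤n
    module B = Leader n' b b+2≤n

    sums-agree : ∀ {x C D} → A.letter x ≡ B.letter x → A.letter x + x ≡ C → B.letter x + x ≡ D → C ≡ D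
    sums-agree {x} eq eqᴬ eqᴮ = trans (sym eqᴬ) (trans (cong (_+ x) eq) eqᴮ)

  leader-parameter-injective : ∀ {x} → x < suc n' → leaderLetter n' a x ≡ leaderLetter n' b x → a ≡ b
  leader-parameter-injective {x} x<n eq with A.block x | B.block x
  ... | inj₁ x≤a | inj₁ x≤b = suc-injective (sums-agree eq (A.letter+pos-low x≤a) (B.letter+pos-low x≤b))
  ... | inj₂ a<x | inj₂ b<x =
    suc-injective (+-cancelˡ-≡ (suc n') (suc a) (suc b)
                               (sums-agree eq (A.letter+pos-high a<x x<n) (B.letter+pos-high b<x x<n)))
  ... | inj₁ x≤a | inj₂ b<x =
    ⊥-elim (low-sum≢high-sum a+2≤n (sums-agree eq (A.letter+pos-low x≤a) (B.letter+pos-high b<x x<n)))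
  ... | inj₂ a<x | inj₁ x≤b =
    ⊥-elim (low-sum≢high-sum b+2≤n (sym (sums-agree eq (A.letter+pos-high a<x x<n) (B.letter+pos-low x≤b))))

module _ {k a b} (a+2≤n : suc (suc a) ≤ 7 + k) (b+2≤n : suc (suc b) ≤ 7 + k) where

  private
    module A = Adjacency (6 + k) a a+2≤n
    module B = Adjacency (6 + k) b b+2≤n

  common-untouched-letter : ∀ {p q} → A.π[ # 1 ↔ # 3 ] ≡ B.π[ p ↔ q ] →
                            ∀ x → Untouched p q x → x ≢ # 1 → x ≢ # 3 → a ≡ b
  common-untouched-letter {p} {q} same x (x≢p , x≢q) x≢1 x≢3 =
    leader-parameter-injective a+2≤n b+2≤n (toℕ<n x) (begin
      leaderLetter (6 + k) a (toℕ x) ≡⟨ A.lookup-π[↔]′ (# 1) (# 3) x x≢1 x≢3 ⟨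
      lookup A.π[ # 1 ↔ # 3 ] x      ≡⟨ cong (λ w → lookup w x) same ⟩
      lookup B.π[ p ↔ q ] x          ≡⟨ B.lookup-π[↔]′ p q x x≢p x≢q ⟩
      leaderLetter (6 + k) b (toℕ x) ∎)
    where open ≡-Reasoning

  -- Transposing positions 1 and 3 leaves the letters at 0, 2 and 4 in place,
  -- and the transposition of p and q leaves at least one of them in place too.
  transposition-determines-parameter : ∀ {p q} → toℕ p < toℕ q → A.π[ # 1 ↔ # 3 ] ≡ B.π[ p ↔ q ] → a ≡ b
  transposition-determines-parameter {p} {q} p<q same
    with touched? p q (# 0) | touched? p q (# 2) | touched? p q (# 4)
  ... | inj₂ untouched | _ | _ = common-untouched-letter same (# 0) untouched (λ ()) (λ ())
  ... | inj₁ _ | inj₂ untouched | _ = common-untouched-letter same (# 2) untouched (λ ()) (λ ())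
  ... | inj₁ _ | inj₁ _ | inj₂ untouched = common-untouched-letter same (# 4) untouched (λ ()) (λ ())
  ... | inj₁ t₀ | inj₁ t₂ | inj₁ t₄ = ⊥-elim (¬touched-three p<q (s≤s z≤n) (s≤s (s≤s (s≤s z≤n))) t₀ t₂ t₄)

  same-adjacency⇒same-parameter :
    ((σ : Word (7 + k)) → IsPerm (7 + k) σ → Adjacent (7 + k) A.π σ → Adjacent (7 + k) B.π σ) → a ≡ b
  same-adjacency⇒same-parameter adjacentᵃ⇒adjacentᵇ
    with B.adjacent⇒admissible (adjacentᵃ⇒adjacentᵇ A.π[ # 1 ↔ # 3 ] (A.π[↔]-isPerm (# 1) (# 3))
                                                     (A.admissible⇒adjacent {# 1} {# 3} admissible₁₃))
    where
    admissible₁₃ : A.Admissible 1 3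
    admissible₁₃ = A.admissible ≤-refl (λ { (() , _) }) (λ { (() , _) }) (λ { (_ , ()) })
  ... | p , q , adm , same = transposition-determines-parameter (<-trans (n<1+n _) (B.Admissible.gap adm)) same

adjacency-determines-parameter :
  ∀ {n' a b} → 6 ≤ n' → (a+2≤n : suc (suc a) ≤ suc n') (b+2≤n : suc (suc b) ≤ suc n') →
  ((σ : Word (suc n')) → IsPerm (suc n') σ →
     Adjacent (suc n') (leaderWord n' a) σ → Adjacent (suc n') (leaderWord n' b) σ) →
  a ≡ b
adjacency-determines-parameter (s≤s (s≤s (s≤s (s≤s (s≤s (s≤s _)))))) = same-adjacency⇒same-parameter

leader-normal-form : ∀ {n'} π → IsLeader (suc n') π →
                     Σ[ m ∈ ℕ ] Σ[ m+2≤n ∈ suc (suc m) ≤ suc n' ] π ≡ leaderWord n' m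
leader-normal-form π (zero , () , _)
leader-normal-form π (suc zero , s≤s () , _)
leader-normal-form {n'} π (suc (suc m) , leader@(_ , m+2≤n , _)) =
  m , m+2≤n , Leader.leaderWith⇒≡leaderWord n' m m+2≤n π leader

leader-adjacency-class : ∀ {n'} → 6 ≤ n' → (π : Word (suc n')) → IsLeader (suc n') π →
                         AdjacencyClassOf (suc n') π
leader-adjacency-class {n'} 6≤n' π isLeader with leader-normal-form π isLeader
... | m , m+2≤n , refl = Adjacency.adjacency-class n' m m+2≤n 6≤n'

leaderWord-toℕ-isLeader : ∀ {n'} (i : Fin n') → IsLeader (suc n') (leaderWord n' (toℕ i))
leaderWord-toℕ-isLeader {n'} i = suc (suc (toℕ i)) , Leader.leaderWord-isLeader n' (toℕ i) (s≤s (toℕ<n i))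

isLeader⇒≡leaderWord : ∀ {n'} π → IsLeader (suc n') π → Σ[ i ∈ Fin n' ] π ≡ leaderWord n' (toℕ i)
isLeader⇒≡leaderWord {n'} π isLeader with leader-normal-form π isLeader
... | m , m+2≤n , refl = fromℕ< (≤-pred m+2≤n) , cong (leaderWord n') (sym (toℕ-fromℕ< (≤-pred m+2≤n)))

proposition13 : (n : ℕ) → 7 ≤ n →
    ((π : Word n) → IsLeader n π →
       Σ[ ρ ∈ Word n ] (IsPerm n ρ ×
         ((σ : Word n) → IsPerm n σ → (Adjacent n π σ ⇔ Equiv n ρ σ))))
    ×
    (Σ[ f ∈ (Fin (n ∸ 1) → Word n) ]
       (((i : Fin (n ∸ 1)) → IsLeader n (f i))
       × ((π : Word n) → IsLeader n π → ∃[ i ]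
            ((σ : Word n) → IsPerm n σ → (Adjacent n π σ ⇔ Adjacent n (f i) σ)))
       × ((i j : Fin (n ∸ 1)) →
            ((σ : Word n) → IsPerm n σ → (Adjacent n (f i) σ ⇔ Adjacent n (f j) σ)) →
            i ≡ j)))
proposition13 (suc n') (s≤s 6≤n') =
  leader-adjacency-class 6≤n' ,
  (λ i → leaderWord n' (toℕ i)) ,
  leaderWord-toℕ-isLeader ,
  (λ π isLeader → same-adjacencies (isLeader⇒≡leaderWord π isLeader)) ,
  λ i j same → toℕ-injective (adjacency-determines-parameter 6≤n' (s≤s (toℕ<n i)) (s≤s (toℕ<n j))
                                                             (λ σ perm → Equivalence.to (same σ perm)))
  where
  same-adjacencies : ∀ {π} → Σ[ i ∈ Fin n' ] π ≡ leaderWord n' (toℕ i) →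
    ∃[ i ] ((σ : Word (suc n')) → IsPerm (suc n') σ →
              (Adjacent (suc n') π σ ⇔ Adjacent (suc n') (leaderWord n' (toℕ i)) σ))
  same-adjacencies (i , refl) = i , λ σ _ → ⇔-id _
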